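{- For a graph $G$, $\gamma_{(2,2,2)}(G)=4$ if and only if at least one of the following holds: (i) $\gamma_{\times2,t}(G)=4$; (ii) $\gamma_t(G)=2$ and $G$ has minimum degree $\delta=1$; (iii) $\gamma_t(G)=2$ and $\gamma_{\times2,t}(G)\ge4$.
   Context: All graphs are finite and simple; $N(v)$ is the open neighbourhood and $f(S)=\sum_{u\in S}f(u)$. $\gamma_{(2,2,2)}(G)$ is the minimum of $\sum_v f(v)$ over functions $f:V(G)\to\{0,1,2\}$ with $f(N(v))\ge2$ for every vertex $v$; it is defined (and considered) only for graphs with minimum degree at least $1$. $\gamma_t(G)$ is the total domination number (minimum size of a set $D$ such that every vertex has a neighbour in $D$). $\gamma_{\times2,t}(G)$ is the double total domination number (minimum size of a set $D$ such that every vertex has at least two neighbours in $D$), defined for graphs of minimum degree at least $2$. -}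

module Defs where

open import Data.Nat using (ℕ; zero; suc; _+_; _≤_; _≥_)
open import Data.Fin using (Fin; zero; suc)
open import Data.Bool using (Bool; true; false; if_then_else_; _∧_)
open import Data.Product using (Σ; ∃; _×_; _,_)
open import Relation.Binary.PropositionalEquality using (_≡_)

record Graph (n : ℕ) : Set where
  field
    adj   : Fin n → Fin n → Bool
    sym   : ∀ u v → adj u v ≡ adj v u
    irrefl : ∀ v → adj v v ≡ false
open Graph public

sumFin : ∀ {n} → (Fin n → ℕ) → ℕ
sumFin {zero}  f = 0
sumFin {suc n} f = f zero + sumFin (λ i → f (suc i))

nbSum : ∀ {n} → Graph n → (Fin n → ℕ) → Fin n → ℕ
nbSum G f v = sumFin (λ u → if adj G v u then f u else 0)

weight : ∀ {n} → (Fin n → ℕ) → ℕ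
weight f = sumFin f

deg : ∀ {n} → Graph n → Fin n → ℕ
deg G v = nbSum G (λ _ → 1) v

MinDegAtLeast : ∀ {n} → Graph n → ℕ → Set
MinDegAtLeast G k = ∀ v → k ≤ deg G v

MinDegEq : ∀ {n} → Graph n → ℕ → Set
MinDegEq G k = MinDegAtLeast G k × ∃ λ v → deg G v ≡ k

ind : ∀ {n} → (Fin n → Bool) → Fin n → ℕ
ind D u = if D u then 1 else 0

size : ∀ {n} → (Fin n → Bool) → ℕ
size D = weight (ind D)

Is222DF : ∀ {n} → Graph n → (Fin n → ℕ) → Set
Is222DF G f = (∀ v → f v ≤ 2) × (∀ v → nbSum G f v ≥ 2)

IsTDS : ∀ {n} → Graph n → (Fin n → Bool) → Set
IsTDS G D = ∀ v → nbSum G (ind D) v ≥ 1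

IsDTDS : ∀ {n} → Graph n → (Fin n → Bool) → Set
IsDTDS G D = ∀ v → nbSum G (ind D) v ≥ 2

Gamma222Eq : ∀ {n} → Graph n → ℕ → Set
Gamma222Eq G k =
  (Σ (_ → ℕ) λ f → Is222DF G f × weight f ≡ k) ×
  (∀ f → Is222DF G f → k ≤ weight f)

GammaTEq : ∀ {n} → Graph n → ℕ → Set
GammaTEq G k =
  (Σ (_ → Bool) λ D → IsTDS G D × size D ≡ k) ×
  (∀ D → IsTDS G D → k ≤ size D)

Gamma2TGeq : ∀ {n} → Graph n → ℕ → Set
Gamma2TGeq G k = ∀ D → IsDTDS G D → k ≤ size D

Gamma2TEq : ∀ {n} → Graph n → ℕ → Set
Gamma2TEq G k =
  (Σ (_ → Bool) λ D → IsDTDS G D × size D ≡ k) × Gamma2TGeq G k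

-- A (2,2,2)-dominating function of weight 4 either takes only the values 0 and 1, and is then
-- the indicator of a double total dominating set, or has a vertex u with f u = 2; then u and a
-- neighbour w with f w ≥ 1 totally dominate G, since a vertex adjacent to neither would see
-- weight at most 4 − 3. Conversely, indicators of double total dominating sets and doubled
-- indicators of total dominating sets are (2,2,2)-dominating, and a (2,2,2)-dominating function
-- of weight below 4 has no value 2 (f u + f(N(u)) ≤ weight f), so it is a double total
-- dominating set; a vertex of degree 1 rules these out altogether.
module Submission where

open import Defs
import Algebra.Properties.CommutativeSemigroup as CommSemigroupProperties
open import Data.Bool using (Bool; true; false; if_then_else_; _∨_)
open import Data.Bool.Properties using (∨-zeroʳ)
open import Data.Empty using (⊥-elim)
open import Data.Fin using (Fin; zero; suc)
open import Data.Fin.Properties as Fin using (any?; all?; ¬∀⟶∃¬)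
open import Data.Nat using (ℕ; zero; suc; _+_; _≤_; _≤ᵇ_; z≤n; s≤s; _≤?_; _≟_)
open import Data.Nat.Properties
  using (≤-trans; ≤-reflexive; ≤-antisym; ≤-pred; +-mono-≤; +-monoʳ-≤; m≤m+n; m≤n+m; +-identityʳ;
         ≰⇒>; <-irrefl; ≤∧≢⇒<; +-commutativeSemigroup; module ≤-Reasoning)
open import Data.Product using (_×_; _,_; Σ; ∃; proj₂)
open import Data.Sum using (_⊎_; inj₁; inj₂; [_,_])
open import Function.Bundles using (_⇔_; mk⇔)
open import Relation.Nullary using (¬_; yes; no; does)
open import Relation.Nullary.Decidable using (dec-true)
open import Relation.Binary.PropositionalEquality as ≡ using (_≡_; refl; trans; cong; cong₂; module ≡-Reasoning)

open CommSemigroupProperties +-commutativeSemigroup using (x∙yz≈y∙xz; interchange)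

sumFin-cong : ∀ {n} {h g : Fin n → ℕ} → (∀ x → h x ≡ g x) → sumFin h ≡ sumFin g
sumFin-cong {zero}  h≡g = refl
sumFin-cong {suc n} h≡g = cong₂ _+_ (h≡g zero) (sumFin-cong (λ i → h≡g (suc i)))

sumFin-mono : ∀ {n} {h g : Fin n → ℕ} → (∀ x → h x ≤ g x) → sumFin h ≤ sumFin g
sumFin-mono {zero}  h≤g = z≤n
sumFin-mono {suc n} h≤g = +-mono-≤ (h≤g zero) (sumFin-mono (λ i → h≤g (suc i)))

sumFin-zero : ∀ {n} → sumFin {n} (λ _ → 0) ≡ 0
sumFin-zero {zero}  = refl
sumFin-zero {suc n} = sumFin-zero {n}

sumFin-+ : ∀ {n} (h g : Fin n → ℕ) → sumFin (λ x → h x + g x) ≡ sumFin h + sumFin g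
sumFin-+ {zero}  h g = refl
sumFin-+ {suc n} h g = begin
  h zero + g zero + sumFin (λ i → h (suc i) + g (suc i))
    ≡⟨ cong (h zero + g zero +_) (sumFin-+ (λ i → h (suc i)) (λ i → g (suc i))) ⟩
  h zero + g zero + (sumFin (λ i → h (suc i)) + sumFin (λ i → g (suc i)))
    ≡⟨ interchange (h zero) (g zero) _ _ ⟩
  h zero + sumFin (λ i → h (suc i)) + (g zero + sumFin (λ i → g (suc i))) ∎
  where open ≡-Reasoning

lookup≤sumFin : ∀ {n} (g : Fin n → ℕ) a → g a ≤ sumFin g
lookup≤sumFin g zero    = m≤m+n (g zero) _
lookup≤sumFin g (suc a) = ≤-trans (lookup≤sumFin (λ i → g (suc i)) a) (m≤n+m _ (g zero))

point+sumFin≤sumFin : ∀ {n} {h g : Fin n → ℕ} a →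
  (∀ x → h x ≤ g x) → h a ≡ 0 → g a + sumFin h ≤ sumFin g
point+sumFin≤sumFin zero h≤g ha rewrite ha =
  +-monoʳ-≤ _ (sumFin-mono (λ i → h≤g (suc i)))
point+sumFin≤sumFin {h = h} {g} (suc a) h≤g ha =
  ≤-trans (≤-reflexive (x∙yz≈y∙xz (g (suc a)) (h zero) _))
          (+-mono-≤ (h≤g zero) (point+sumFin≤sumFin a (λ i → h≤g (suc i)) ha))

points+sumFin≤sumFin : ∀ {n} {h g : Fin n → ℕ} a b → ¬ a ≡ b →
  (∀ x → h x ≤ g x) → h a ≡ 0 → h b ≡ 0 → g a + (g b + sumFin h) ≤ sumFin g
points+sumFin≤sumFin zero zero a≢b _ _ _ = ⊥-elim (a≢b refl)
points+sumFin≤sumFin zero (suc b) _ h≤g ha hb rewrite ha =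
  +-monoʳ-≤ _ (point+sumFin≤sumFin b (λ i → h≤g (suc i)) hb)
points+sumFin≤sumFin {g = g} (suc a) zero _ h≤g ha hb rewrite hb =
  ≤-trans (≤-reflexive (x∙yz≈y∙xz (g (suc a)) (g zero) _))
          (+-monoʳ-≤ _ (point+sumFin≤sumFin a (λ i → h≤g (suc i)) ha))
points+sumFin≤sumFin {h = h} {g} (suc a) (suc b) a≢b h≤g ha hb = begin
  g (suc a) + (g (suc b) + (h zero + sumFin h′))
    ≡⟨ cong (g (suc a) +_) (x∙yz≈y∙xz (g (suc b)) (h zero) _) ⟩
  g (suc a) + (h zero + (g (suc b) + sumFin h′))
    ≡⟨ x∙yz≈y∙xz (g (suc a)) (h zero) _ ⟩
  h zero + (g (suc a) + (g (suc b) + sumFin h′))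
    ≤⟨ +-mono-≤ (h≤g zero)
         (points+sumFin≤sumFin a b (λ a≡b → a≢b (cong suc a≡b)) (λ i → h≤g (suc i)) ha hb) ⟩
  g zero + sumFin (λ i → g (suc i)) ∎
  where
  open ≤-Reasoning
  h′ = λ i → h (suc i)

lookup+lookup≤sumFin : ∀ {n} (g : Fin n → ℕ) a b → ¬ a ≡ b → g a + g b ≤ sumFin g
lookup+lookup≤sumFin {n} g a b a≢b = begin
  g a + g b                          ≡⟨ cong (g a +_) (≡.sym (+-identityʳ (g b))) ⟩
  g a + (g b + 0)                    ≡⟨ cong (λ s → g a + (g b + s)) (≡.sym (sumFin-zero {n})) ⟩
  g a + (g b + sumFin {n} (λ _ → 0)) ≤⟨ points+sumFin≤sumFin a b a≢b (λ _ → z≤n) refl refl ⟩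
  sumFin g                           ∎
  where open ≤-Reasoning

sumFin-positive⇒∃ : ∀ {n} (h : Fin n → ℕ) → 1 ≤ sumFin h → ∃ λ x → 1 ≤ h x
sumFin-positive⇒∃ {suc n} h 1≤Σh with h zero in h0
... | suc _ = zero , ≤-trans (s≤s z≤n) (≤-reflexive (≡.sym h0))
... | zero  with sumFin-positive⇒∃ (λ i → h (suc i)) 1≤Σh
...   | x , 1≤hx = suc x , 1≤hx

if-then-0≤ : ∀ b {m} → (if b then m else 0) ≤ m
if-then-0≤ true  = ≤-reflexive refl
if-then-0≤ false = z≤n

if-then-0-mono : ∀ b {m n} → m ≤ n → (if b then m else 0) ≤ (if b then n else 0)
if-then-0-mono true  m≤n = m≤n
if-then-0-mono false _   = z≤n

if-then-0-+ : ∀ b {m n} → (if b then m + n else 0) ≡ (if b then m else 0) + (if b then n else 0)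
if-then-0-+ true  = refl
if-then-0-+ false = refl

if-then-0-positive : ∀ b {m} → 1 ≤ (if b then m else 0) → b ≡ true × 1 ≤ m
if-then-0-positive true 1≤m = refl , 1≤m

ind≤1 : ∀ {n} (D : Fin n → Bool) x → ind D x ≤ 1
ind≤1 D x with D x
... | true  = ≤-reflexive refl
... | false = z≤n

ind-∨ : ∀ {n} (D E : Fin n → Bool) x → ind (λ y → D y ∨ E y) x ≤ ind D x + ind E x
ind-∨ D E x with D x | E x
... | true  | _     = s≤s z≤n
... | false | true  = s≤s z≤n
... | false | false = z≤n

size-∨≤ : ∀ {n} (D E : Fin n → Bool) → size (λ x → D x ∨ E x) ≤ size D + size E
size-∨≤ D E = ≤-trans (sumFin-mono (ind-∨ D E)) (≤-reflexive (sumFin-+ (ind D) (ind E)))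

singleton : ∀ {n} → Fin n → Fin n → Bool
singleton u x = does (x Fin.≟ u)

size-singleton : ∀ {n} (u : Fin n) → size (singleton u) ≡ 1
size-singleton {suc n} zero    = cong suc (sumFin-zero {n})
size-singleton         (suc u) = size-singleton u

pair : ∀ {n} → Fin n → Fin n → Fin n → Bool
pair u w x = singleton u x ∨ singleton w x

size-pair≤2 : ∀ {n} (u w : Fin n) → size (pair u w) ≤ 2
size-pair≤2 u w = ≤-trans (size-∨≤ (singleton u) (singleton w))
                          (≤-reflexive (cong₂ _+_ (size-singleton u) (size-singleton w)))

pair-∋ˡ : ∀ {n} (u w : Fin n) → 1 ≤ ind (pair u w) u
pair-∋ˡ u w rewrite dec-true (u Fin.≟ u) refl = ≤-reflexive refl

pair-∋ʳ : ∀ {n} (u w : Fin n) → 1 ≤ ind (pair u w) w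
pair-∋ʳ u w rewrite dec-true (w Fin.≟ w) refl | ∨-zeroʳ (singleton u w) = ≤-reflexive refl

support : ∀ {n} → (Fin n → ℕ) → Fin n → Bool
support f x = 1 ≤ᵇ f x

ind-support : ∀ {n} (f : Fin n → ℕ) x → f x ≤ 1 → ind (support f) x ≡ f x
ind-support f x fx≤1 with f x
... | zero        = refl
... | suc zero    = refl
... | suc (suc _) with s≤s () ← fx≤1

module _ {n} (G : Graph n) where

  adj⇒≢ : ∀ {u v} → adj G u v ≡ true → ¬ u ≡ v
  adj⇒≢ {u} u~v refl with trans (≡.sym u~v) (irrefl G u)
  ... | ()

  nbSum-cong : ∀ {f g : Fin n → ℕ} → (∀ x → f x ≡ g x) → ∀ v → nbSum G f v ≡ nbSum G g v
  nbSum-cong f≡g v = sumFin-cong (λ x → cong (λ m → if adj G v x then m else 0) (f≡g x))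

  nbSum-mono : ∀ {f g : Fin n → ℕ} → (∀ x → f x ≤ g x) → ∀ v → nbSum G f v ≤ nbSum G g v
  nbSum-mono f≤g v = sumFin-mono (λ x → if-then-0-mono (adj G v x) (f≤g x))

  nbSum-+ : ∀ (f g : Fin n → ℕ) v → nbSum G (λ x → f x + g x) v ≡ nbSum G f v + nbSum G g v
  nbSum-+ f g v = trans (sumFin-cong (λ x → if-then-0-+ (adj G v x)))
                        (sumFin-+ (λ x → if adj G v x then f x else 0) (λ x → if adj G v x then g x else 0))

  self+nbSum≤weight : ∀ f v → f v + nbSum G f v ≤ weight f
  self+nbSum≤weight f v = point+sumFin≤sumFin v (λ x → if-then-0≤ (adj G v x))
    (cong (λ b → if b then f v else 0) (irrefl G v))

  nonNeighbours+nbSum≤weight : ∀ f {u w v} → ¬ u ≡ w →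
    adj G v u ≡ false → adj G v w ≡ false → f u + (f w + nbSum G f v) ≤ weight f
  nonNeighbours+nbSum≤weight f {u} {w} u≢w v≁u v≁w = points+sumFin≤sumFin u w u≢w
    (λ x → if-then-0≤ (adj G _ x))
    (cong (λ b → if b then f u else 0) v≁u) (cong (λ b → if b then f w else 0) v≁w)

  neighbour⇒nbSum-positive : ∀ f {v x} → adj G v x ≡ true → 1 ≤ f x → 1 ≤ nbSum G f v
  neighbour⇒nbSum-positive f {v} {x} v~x 1≤fx = ≤-trans 1≤fx (≤-trans
    (≤-reflexive (cong (λ b → if b then f x else 0) (≡.sym v~x)))
    (lookup≤sumFin (λ y → if adj G v y then f y else 0) x))

  nbSum-positive⇒neighbour : ∀ f v → 1 ≤ nbSum G f v → ∃ λ x → adj G v x ≡ true × 1 ≤ f x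
  nbSum-positive⇒neighbour f v 1≤nb with sumFin-positive⇒∃ _ 1≤nb
  ... | x , 1≤fx = x , if-then-0-positive (adj G v x) 1≤fx

  IsTDS⇒2≤size : ∀ {D} → Fin n → IsTDS G D → 2 ≤ size D
  IsTDS⇒2≤size {D} v tds with nbSum-positive⇒neighbour (ind D) v (tds v)
  ... | a , _ , a∈D with nbSum-positive⇒neighbour (ind D) a (tds a)
  ...   | b , a~b , b∈D =
    ≤-trans (+-mono-≤ a∈D b∈D) (lookup+lookup≤sumFin (ind D) a b (adj⇒≢ a~b))

  pair-IsTDS⇒γt≡2 : ∀ u w → IsTDS G (pair u w) → GammaTEq G 2
  pair-IsTDS⇒γt≡2 u w tds =
    (pair u w , tds , ≤-antisym (size-pair≤2 u w) (IsTDS⇒2≤size u tds)) , λ _ → IsTDS⇒2≤size u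

  IsDTDS⇒222DF : ∀ {D} → IsDTDS G D → Is222DF G (ind D)
  IsDTDS⇒222DF {D} dtds = (λ x → ≤-trans (ind≤1 D x) (s≤s z≤n)) , dtds

  IsTDS⇒222DF : ∀ {D} → IsTDS G D → Σ (Fin n → ℕ) λ f → Is222DF G f × weight f ≡ size D + size D
  IsTDS⇒222DF {D} tds =
    (λ x → ind D x + ind D x) ,
    ((λ x → +-mono-≤ (ind≤1 D x) (ind≤1 D x)) ,
     (λ v → ≤-trans (+-mono-≤ (tds v) (tds v)) (≤-reflexive (≡.sym (nbSum-+ (ind D) (ind D) v))))) ,
    sumFin-+ (ind D) (ind D)

  222DF-with-2⇒4≤weight : ∀ {f u} → Is222DF G f → f u ≡ 2 → 4 ≤ weight f
  222DF-with-2⇒4≤weight {f} {u} (_ , nb) fu≡2 =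
    ≤-trans (+-mono-≤ (≤-reflexive (≡.sym fu≡2)) (nb u)) (self+nbSum≤weight f u)

  222DF-without-2⇒DTDS : ∀ {f} → Is222DF G f → ¬ (∃ λ u → f u ≡ 2) →
    IsDTDS G (support f) × size (support f) ≡ weight f
  222DF-without-2⇒DTDS {f} (f≤2 , nb) no2 =
    (λ v → ≤-trans (nb v) (≤-reflexive (≡.sym (nbSum-cong ind≡f v)))) , sumFin-cong ind≡f
    where
    ind≡f : ∀ x → ind (support f) x ≡ f x
    ind≡f x = ind-support f x (≤-pred (≤∧≢⇒< (f≤2 x) (λ fx≡2 → no2 (x , fx≡2))))

  222DF-lower⇒Gamma2TGeq : ∀ {k} → (∀ f → Is222DF G f → k ≤ weight f) → Gamma2TGeq G k
  222DF-lower⇒Gamma2TGeq lower D dtds = lower (ind D) (IsDTDS⇒222DF dtds)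

  Gamma2TGeq⇒222DF-4≤weight : Gamma2TGeq G 4 → ∀ f → Is222DF G f → 4 ≤ weight f
  Gamma2TGeq⇒222DF-4≤weight γ×2t≥4 f df with any? (λ u → f u ≟ 2)
  ... | yes (_ , fu≡2) = 222DF-with-2⇒4≤weight df fu≡2
  ... | no no2 with 222DF-without-2⇒DTDS df no2
  ...   | dtds , size≡weight = ≤-trans (γ×2t≥4 _ dtds) (≤-reflexive size≡weight)

  -- A vertex adjacent to neither u nor w sees at most 4 − f u − f w ≤ 1.
  heavyEdge⇒pair-IsTDS : ∀ {f u w} → Is222DF G f → weight f ≤ 4 → f u ≡ 2 →
    adj G u w ≡ true → 1 ≤ f w → IsTDS G (pair u w)
  heavyEdge⇒pair-IsTDS {f} {u} {w} (_ , nb) w≤4 fu≡2 u~w 1≤fw v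
    with adj G v u in v~u | adj G v w in v~w
  ... | true  | _     = neighbour⇒nbSum-positive (ind (pair u w)) v~u (pair-∋ˡ u w)
  ... | false | true  = neighbour⇒nbSum-positive (ind (pair u w)) v~w (pair-∋ʳ u w)
  ... | false | false = ⊥-elim (<-irrefl refl (begin
    5                               ≤⟨ +-mono-≤ (≤-reflexive (≡.sym fu≡2)) (+-mono-≤ 1≤fw (nb v)) ⟩
    f u + (f w + nbSum G f v)       ≤⟨ nonNeighbours+nbSum≤weight f (adj⇒≢ u~w) v~u v~w ⟩
    weight f                        ≤⟨ w≤4 ⟩
    4                               ∎))
    where open ≤-Reasoning

  deg≡1⇒¬IsDTDS : ∀ {v D} → deg G v ≡ 1 → ¬ IsDTDS G D
  deg≡1⇒¬IsDTDS {v} {D} deg≡1 dtds =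
    <-irrefl refl (≤-trans (dtds v) (≤-trans (nbSum-mono (ind≤1 D) v) (≤-reflexive deg≡1)))

  minDeg≥1⇒≥2⊎≡1 : MinDegAtLeast G 1 → MinDegAtLeast G 2 ⊎ MinDegEq G 1
  minDeg≥1⇒≥2⊎≡1 δ≥1 with all? (λ v → 2 ≤? deg G v)
  ... | yes δ≥2 = inj₁ δ≥2
  ... | no ¬δ≥2 with ¬∀⟶∃¬ n _ (λ v → 2 ≤? deg G v) ¬δ≥2
  ...   | v , deg≱2 = inj₂ (δ≥1 , v , ≤-antisym (≤-pred (≰⇒> deg≱2)) (δ≥1 v))

theorem3p15 : ∀ (n : ℕ) (G : Graph n) → MinDegAtLeast G 1 →
    (Gamma222Eq G 4 ⇔
      (Gamma2TEq G 4
        ⊎ (GammaTEq G 2 × MinDegEq G 1)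
        ⊎ (GammaTEq G 2 × MinDegAtLeast G 2 × Gamma2TGeq G 4)))
theorem3p15 n G δ≥1 = mk⇔ forward backward
  where
  splitOnMinDeg : GammaTEq G 2 → Gamma2TGeq G 4 →
    (GammaTEq G 2 × MinDegEq G 1) ⊎ (GammaTEq G 2 × MinDegAtLeast G 2 × Gamma2TGeq G 4)
  splitOnMinDeg γt≡2 γ×2t≥4 =
    [ (λ δ≥2 → inj₂ (γt≡2 , δ≥2 , γ×2t≥4)) , (λ δ≡1 → inj₁ (γt≡2 , δ≡1)) ] (minDeg≥1⇒≥2⊎≡1 G δ≥1)

  forward : Gamma222Eq G 4 → _
  forward ((f , df , weight≡4) , minimal) with any? (λ u → f u ≟ 2)
  ... | no no2 with 222DF-without-2⇒DTDS G df no2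
  ...   | dtds , size≡weight =
    inj₁ ((support f , dtds , trans size≡weight weight≡4) , 222DF-lower⇒Gamma2TGeq G minimal)
  forward ((f , df , weight≡4) , minimal) | yes (u , fu≡2)
    with nbSum-positive⇒neighbour G f u (≤-trans (s≤s z≤n) (proj₂ df u))
  ... | w , u~w , 1≤fw = inj₂ (splitOnMinDeg
    (pair-IsTDS⇒γt≡2 G u w (heavyEdge⇒pair-IsTDS G df (≤-reflexive weight≡4) fu≡2 u~w 1≤fw))
    (222DF-lower⇒Gamma2TGeq G minimal))

  doubled : ∀ {D} → IsTDS G D → size D ≡ 2 → Σ (Fin n → ℕ) λ f → Is222DF G f × weight f ≡ 4
  doubled tds size≡2 with IsTDS⇒222DF G tds
  ... | f , df , weight≡2size = f , df , trans weight≡2size (cong₂ _+_ size≡2 size≡2)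

  backward : _ → Gamma222Eq G 4
  backward (inj₁ ((D , dtds , size≡4) , γ×2t≥4)) =
    (ind D , IsDTDS⇒222DF G dtds , size≡4) , Gamma2TGeq⇒222DF-4≤weight G γ×2t≥4
  backward (inj₂ (inj₁ (((_ , tds , size≡2) , _) , _ , _ , deg≡1))) =
    doubled tds size≡2 , Gamma2TGeq⇒222DF-4≤weight G (λ _ dtds → ⊥-elim (deg≡1⇒¬IsDTDS G deg≡1 dtds))
  backward (inj₂ (inj₂ (((_ , tds , size≡2) , _) , _ , γ×2t≥4))) =
    doubled tds size≡2 , Gamma2TGeq⇒222DF-4≤weight G γ×2t≥4
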